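{- Let $G=(V,E)$ be a connected graph with a fixed spanning tree $T$ and a given vertex $u$, and let $\alpha,\beta$ be two proper 3-colourings of $G$. Let $k$ be an integer with $k\equiv 2(\alpha(u)-\beta(u))\pmod 6$. If $R=c_0,\dots,c_\ell$ is a recolouring with $c_0=\alpha$ such that $H_u^R(c_\ell,v)=k+h_{\alpha,u}(\beta,v)$ for all $v\in V$, then $c_\ell=\beta$.
   Context: A proper 3-colouring is a map $c:V\to\{1,2,3\}$ with $c(x)\ne c(y)$ for all $xy\in E$. A recolouring is a sequence $c_0,\dots,c_\ell$ of proper 3-colourings in which consecutive colourings disagree on at most one vertex. For an edge oriented from $x$ to $y$, $w(c,\overrightarrow{xy})\in\{ -1,1\}$ satisfies $w(c,\overrightarrow{xy})\equiv c(y)-c(x)\pmod 3$; path weights are sums of edge weights; $\overrightarrow{P_{uv}}$ is the $u$–$v$ path in $T$ oriented from $u$ to $v$; $h_{\alpha,u}(c,v)=w(c,\overrightarrow{P_{uv}})-w(\alpha,\overrightarrow{P_{uv}})$. Absolute heights (indexed by position $i$ in $R$): $H_u^R(c_0,u)=0$; for $i>0$, $H_u^R(c_i,u)=H_u^R(c_{i-1},u)$ if $c_i(u)=c_{i-1}(u)$, $=H_u^R(c_{i-1},u)+2$ if $c_i(u)\equiv c_{i-1}(u)-1\pmod3$, $=H_u^R(c_{i-1},u)-2$ if $c_i(u)\equiv c_{i-1}(u)+1\pmod3$; and $H_u^R(c_i,v)=H_u^R(c_i,u)+h_{\alpha,u}(c_i,v)$. -}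

module Defs where

open import Data.Nat using (ℕ; zero; suc; _<_; _≤_)
open import Data.Nat.DivMod using (_%_)
open import Data.Fin using (Fin; toℕ)
open import Data.Integer as ℤ using (ℤ; +_; -_; _-_)
open import Data.List using (List; []; _∷_)
open import Data.List.Relation.Unary.Unique.Propositional using (Unique)
open import Data.Product using (Σ; ∃; _×_; _,_)
open import Relation.Binary.PropositionalEquality using (_≡_; _≢_)
open import Relation.Nullary using (¬_)

record Graph : Set₁ where
  field
    n    : ℕ
    E    : Fin n → Fin n → Set
    sym  : ∀ {x y} → E x y → E y x
    irr  : ∀ {x} → ¬ E x x
open Graph public

Colouring : Graph → Set
Colouring G = Fin (n G) → Fin 3

Proper : (G : Graph) → Colouring G → Set
Proper G c = ∀ x y → E G x y → c x ≢ c y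

data TPath {m : ℕ} (T : Fin m → Fin m → Set) : Fin m → Fin m → Set where
  here : ∀ {x} → TPath T x x
  step : ∀ {x y z} → T x y → TPath T y z → TPath T x z

verts : ∀ {m} {T : Fin m → Fin m → Set} {x y} → TPath T x y → List (Fin m)
verts {x = x} here = x ∷ []
verts {x = x} (step _ p) = x ∷ verts p

SimplePath : ∀ {m} {T : Fin m → Fin m → Set} {x y} → TPath T x y → Set
SimplePath p = Unique (verts p)

record IsSpanningTree (G : Graph) (T : Fin (n G) → Fin (n G) → Set) : Set where
  field
    sub      : ∀ {x y} → T x y → E G x y
    tsym     : ∀ {x y} → T x y → T y x
    connected : ∀ x y → Σ (TPath T x y) SimplePath
    unique   : ∀ {x y} (p q : TPath T x y) → SimplePath p → SimplePath q →
               verts p ≡ verts q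

diff3 : Fin 3 → Fin 3 → ℕ
diff3 a b = (toℕ b ℕ.+ 3 ℕ.∸ toℕ a) % 3
  where import Data.Nat as ℕ

-- w(c, x→y) ∈ {-1,1} with w ≡ c(y) - c(x) (mod 3)  (for c(x) ≠ c(y))
edgeWeight : Fin 3 → Fin 3 → ℤ
edgeWeight a b with diff3 a b
... | 1 = + 1
... | _ = - (+ 1)

weight : ∀ {m} {T : Fin m → Fin m → Set} {x y} → (Fin m → Fin 3) → TPath T x y → ℤ
weight c here = + 0
weight {x = x} c (step {y = y} _ p) = edgeWeight (c x) (c y) ℤ.+ weight c p

h : ∀ {m} {T : Fin m → Fin m → Set} {u v} → (α c : Fin m → Fin 3) → TPath T u v → ℤ
h α c P = weight c P - weight α P

-- Recolouring: c₀ … c_ℓ given as cs : ℕ → Colouring (indices > ℓ irrelevant)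
Recolouring : (G : Graph) → (ℓ : ℕ) → (ℕ → Colouring G) → Set
Recolouring G ℓ cs =
  (∀ i → i ≤ ℓ → Proper G (cs i)) ×
  (∀ i → i < ℓ → ∃ λ v → ∀ x → x ≢ v → cs i x ≡ cs (suc i) x)

-- change of the absolute height at u when the colour of u goes from a to b
heightStep : Fin 3 → Fin 3 → ℤ
heightStep a b with diff3 a b
... | 0 = + 0
... | 2 = + 2     -- b ≡ a - 1 (mod 3)
... | _ = - (+ 2) -- b ≡ a + 1 (mod 3)

Hu : (G : Graph) → (ℕ → Colouring G) → Fin (n G) → ℕ → ℤ
Hu G cs u zero = + 0
Hu G cs u (suc i) = Hu G cs u i ℤ.+ heightStep (cs i u) (cs (suc i) u)

Hv : ∀ (G : Graph) {T : Fin (n G) → Fin (n G) → Set} {u v} →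
     (α : Colouring G) → (ℕ → Colouring G) → ℕ → TPath T u v → ℤ
Hv G {u = u} α cs i P = Hu G cs u i ℤ.+ h α (cs i) P

-- The height of u changes by ±2 exactly when its colour changes by ∓1, so H_u^R(c_i, u) and
-- 2(c_0(u) - c_i(u)) agree mod 6 throughout R; comparing with k pins down c_ℓ(u) = β(u).
-- The hypothesis then forces c_ℓ and β to have equal weight along the tree path from u to v,
-- and the weight of a path under a proper colouring is congruent mod 3 to the colour
-- difference of its endpoints, so c_ℓ(v) = β(v) as well.
module Submission where

open import Defs hiding (sym)
open import Data.Nat using (ℕ; zero; suc; NonZero; _<_)
open import Data.Nat.Properties using (≤-refl; ≤-<-trans; ⊔-lub)
import Data.Nat as ℕ
open import Data.Nat.Divisibility using (>⇒∤)
open import Data.Fin using (Fin; toℕ)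
open import Data.Fin.Properties using (toℕ<n; toℕ-injective; all?; _≟_)
open import Data.Integer using (ℤ; +_; -[1+_]; -_; _-_; _*_; _+_; ∣_∣)
open import Data.Integer.Properties
  using (+-inverseʳ; +-injective; i-j≡0⇒i≡j; ∣m⊝n∣≤m⊔n; [+m]-[+n]≡m⊖n; pos-*;
         +-0-abelianGroup)
open import Data.Integer.Divisibility using (_∣_)
open import Data.Integer.Divisibility.Signed as Signed
  using (divides; ∣ᵤ⇒∣; ∣⇒∣ᵤ; ∣m⇒∣-m; ∣m∣n⇒∣m+n; *-cancelˡ-∣; _∣?_)
open import Data.Integer.Tactic.RingSolver using (solve-∀)
open import Data.Product using (_,_; proj₁; proj₂)
open import Data.List.Relation.Unary.All using ([])
open import Data.List.Relation.Unary.AllPairs using ([]; _∷_)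
open import Algebra.Properties.AbelianGroup +-0-abelianGroup using (∙-cancelˡ; ∙-cancelʳ)
open import Relation.Binary.Bundles using (Setoid)
import Relation.Binary.Reasoning.Setoid as ≈-Reasoning
open import Function using (_∘_)
open import Relation.Binary.PropositionalEquality
  using (_≡_; _≢_; refl; sym; cong; subst; subst₂)
open import Relation.Nullary.Decidable using (from-yes; _→-dec_; ¬?)
open import Relation.Nullary.Negation using (contradiction)

infix 4 _≡_mod_
record _≡_mod_ (i j : ℤ) (m : ℕ) : Set where
  constructor mod-divides
  field divides-difference : + m Signed.∣ i - j
open _≡_mod_

module _ {m : ℕ} where

  ≡⇒≡-mod : ∀ {i j} → i ≡ j → i ≡ j mod m
  ≡⇒≡-mod {i} refl = mod-divides (divides (+ 0) (+-inverseʳ i))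

  ≡-mod-sym : ∀ {i j} → i ≡ j mod m → j ≡ i mod m
  ≡-mod-sym {i} {j} (mod-divides m∣i-j) =
    mod-divides (subst (+ m Signed.∣_) (negate i j) (∣m⇒∣-m m∣i-j))
    where
    negate : ∀ i j → - (i - j) ≡ j - i
    negate = solve-∀

  ≡-mod-trans : ∀ {i j k} → i ≡ j mod m → j ≡ k mod m → i ≡ k mod m
  ≡-mod-trans {i} {j} {k} (mod-divides m∣i-j) (mod-divides m∣j-k) =
    mod-divides (subst (+ m Signed.∣_) (telescope i j k) (∣m∣n⇒∣m+n m∣i-j m∣j-k))
    where
    telescope : ∀ i j k → (i - j) + (j - k) ≡ i - k
    telescope = solve-∀

  +-cong-mod : ∀ {i j k l} → i ≡ j mod m → k ≡ l mod m → i + k ≡ j + l mod m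
  +-cong-mod {i} {j} {k} {l} (mod-divides m∣i-j) (mod-divides m∣k-l) =
    mod-divides (subst (+ m Signed.∣_) (regroup i j k l) (∣m∣n⇒∣m+n m∣i-j m∣k-l))
    where
    regroup : ∀ i j k l → (i - j) + (k - l) ≡ (i + k) - (j + l)
    regroup = solve-∀

≡-mod-setoid : ℕ → Setoid _ _
≡-mod-setoid m = record
  { Carrier = ℤ
  ; _≈_ = λ i j → i ≡ j mod m
  ; isEquivalence = record { refl = ≡⇒≡-mod refl ; sym = ≡-mod-sym ; trans = ≡-mod-trans }
  }

*-cancelˡ-≡-mod : ∀ d {m i j} .{{_ : NonZero d}} →
  + d * i ≡ + d * j mod d ℕ.* m → i ≡ j mod m
*-cancelˡ-≡-mod d {m} {i} {j} (mod-divides dm∣di-dj) =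
  mod-divides (*-cancelˡ-∣ (+ d) (subst₂ Signed._∣_ (pos-* d m) (factor (+ d) i j) dm∣di-dj))
  where
  factor : ∀ d i j → d * i - d * j ≡ d * (i - j)
  factor = solve-∀

∣∧∣<∣⇒≡0 : ∀ {k i} → k ∣ i → ∣ i ∣ < ∣ k ∣ → i ≡ + 0
∣∧∣<∣⇒≡0 {i = + zero}    _   _   = refl
∣∧∣<∣⇒≡0 {i = + suc _}   k∣i i<k = contradiction k∣i (>⇒∤ i<k)
∣∧∣<∣⇒≡0 {i = -[1+ _ ]} k∣i i<k = contradiction k∣i (>⇒∤ i<k)

toℕ-≡-mod⇒≡ : ∀ {m} {a b : Fin m} → + toℕ a ≡ + toℕ b mod m → a ≡ b
toℕ-≡-mod⇒≡ {m} {a} {b} (mod-divides m∣a-b) =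
  toℕ-injective (+-injective (i-j≡0⇒i≡j _ _ (∣∧∣<∣⇒≡0 {+ m} (∣⇒∣ᵤ m∣a-b) ∣a-b∣<m)))
  where
  ∣a-b∣<m : ∣ + toℕ a - + toℕ b ∣ < m
  ∣a-b∣<m rewrite [+m]-[+n]≡m⊖n (toℕ a) (toℕ b) =
    ≤-<-trans (∣m⊝n∣≤m⊔n (toℕ a) (toℕ b)) (⊔-lub (toℕ<n a) (toℕ<n b))

heightStep≡-mod-6 : ∀ a b → heightStep a b ≡ + 2 * (+ toℕ a - + toℕ b) mod 6
heightStep≡-mod-6 a b = mod-divides (from-yes (all? λ a → all? λ b →
  + 6 ∣? heightStep a b - + 2 * (+ toℕ a - + toℕ b)) a b)

edgeWeight≡-mod-3 : ∀ a b → a ≢ b → edgeWeight a b ≡ + toℕ b - + toℕ a mod 3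
edgeWeight≡-mod-3 a b a≢b = mod-divides (from-yes (all? λ a → all? λ b →
  ¬? (a ≟ b) →-dec (+ 3 ∣? edgeWeight a b - (+ toℕ b - + toℕ a))) a b a≢b)

Hu≡-mod-6 : ∀ G (cs : ℕ → Colouring G) u i →
  Hu G cs u i ≡ + 2 * (+ toℕ (cs 0 u) - + toℕ (cs i u)) mod 6
Hu≡-mod-6 G cs u zero = ≡⇒≡-mod (sym (twice-self-difference (+ toℕ (cs 0 u))))
  where
  twice-self-difference : ∀ x → + 2 * (x - x) ≡ + 0
  twice-self-difference = solve-∀
Hu≡-mod-6 G cs u (suc i) = begin
  Hu G cs u i + heightStep (cs i u) (cs (suc i) u)
    ≈⟨ +-cong-mod (Hu≡-mod-6 G cs u i) (heightStep≡-mod-6 (cs i u) (cs (suc i) u)) ⟩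
  + 2 * (c₀ - cᵢ) + + 2 * (cᵢ - cᵢ₊₁)
    ≡⟨ twice-telescope c₀ cᵢ cᵢ₊₁ ⟩
  + 2 * (c₀ - cᵢ₊₁) ∎
  where
  open ≈-Reasoning (≡-mod-setoid 6)
  c₀ = + toℕ (cs 0 u)
  cᵢ = + toℕ (cs i u)
  cᵢ₊₁ = + toℕ (cs (suc i) u)
  twice-telescope : ∀ x y z → + 2 * (x - y) + + 2 * (y - z) ≡ + 2 * (x - z)
  twice-telescope = solve-∀

Hu≡⇒colour-≡ : ∀ G (cs : ℕ → Colouring G) u i b {k} → Hu G cs u i ≡ k →
  k ≡ + 2 * (+ toℕ (cs 0 u) - + toℕ b) mod 6 → cs i u ≡ b
Hu≡⇒colour-≡ G cs u i b {k} Hu≡k k≡2[c₀-b] =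
  toℕ-≡-mod⇒≡ (*-cancelˡ-≡-mod 2 (mod-divides
    (subst (+ 6 Signed.∣_) (difference c₀ cᵢ b′) (divides-difference 2[c₀-b]≡2[c₀-cᵢ]))))
  where
  open ≈-Reasoning (≡-mod-setoid 6)
  c₀ = + toℕ (cs 0 u)
  cᵢ = + toℕ (cs i u)
  b′ = + toℕ b
  2[c₀-b]≡2[c₀-cᵢ] : + 2 * (c₀ - b′) ≡ + 2 * (c₀ - cᵢ) mod 6
  2[c₀-b]≡2[c₀-cᵢ] = begin
    + 2 * (c₀ - b′) ≈⟨ k≡2[c₀-b] ⟨
    k               ≡⟨ Hu≡k ⟨
    Hu G cs u i     ≈⟨ Hu≡-mod-6 G cs u i ⟩
    + 2 * (c₀ - cᵢ) ∎
  difference : ∀ x y z → + 2 * (x - z) - + 2 * (x - y) ≡ + 2 * y - + 2 * z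
  difference = solve-∀

module _ {m} {T : Fin m → Fin m → Set} where

  weight≡-mod-3 : ∀ (c : Fin m → Fin 3) → (∀ {x y} → T x y → c x ≢ c y) →
    ∀ {x y} (P : TPath T x y) → weight c P ≡ + toℕ (c y) - + toℕ (c x) mod 3
  weight≡-mod-3 c proper {x} here = ≡⇒≡-mod (sym (+-inverseʳ (+ toℕ (c x))))
  weight≡-mod-3 c proper {x} (step {y = y} {z = z} e P) = begin
    edgeWeight (c x) (c y) + weight c P
      ≈⟨ +-cong-mod (edgeWeight≡-mod-3 (c x) (c y) (proper e)) (weight≡-mod-3 c proper P) ⟩
    (+ toℕ (c y) - + toℕ (c x)) + (+ toℕ (c z) - + toℕ (c y))
      ≡⟨ telescope (+ toℕ (c z)) (+ toℕ (c y)) (+ toℕ (c x)) ⟩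
    + toℕ (c z) - + toℕ (c x) ∎
    where
    open ≈-Reasoning (≡-mod-setoid 3)
    telescope : ∀ i j k → (j - k) + (i - j) ≡ i - k
    telescope = solve-∀

  weight≡⇒colour-≡ : ∀ {c c′ : Fin m → Fin 3} →
    (∀ {x y} → T x y → c x ≢ c y) → (∀ {x y} → T x y → c′ x ≢ c′ y) →
    ∀ {x y} (P : TPath T x y) → c x ≡ c′ x → weight c P ≡ weight c′ P → c y ≡ c′ y
  weight≡⇒colour-≡ {c} {c′} proper proper′ {x} {y} P cx≡c′x same-weight = toℕ-≡-mod⇒≡ (begin
    + toℕ (c y)                          ≡⟨ shift (+ toℕ (c y)) (+ toℕ (c x)) ⟩
    (+ toℕ (c y) - + toℕ (c x)) + + toℕ (c x)
      ≈⟨ +-cong-mod (≡-mod-sym (weight≡-mod-3 c proper P)) (≡⇒≡-mod (cong (+_ ∘ toℕ) cx≡c′x)) ⟩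
    weight c P + + toℕ (c′ x)             ≡⟨ cong (_+ + toℕ (c′ x)) same-weight ⟩
    weight c′ P + + toℕ (c′ x)
      ≈⟨ +-cong-mod (weight≡-mod-3 c′ proper′ P) (≡⇒≡-mod refl) ⟩
    (+ toℕ (c′ y) - + toℕ (c′ x)) + + toℕ (c′ x) ≡⟨ shift (+ toℕ (c′ y)) (+ toℕ (c′ x)) ⟨
    + toℕ (c′ y)                         ∎)
    where
    open ≈-Reasoning (≡-mod-setoid 3)
    shift : ∀ i j → i ≡ (i - j) + j
    shift = solve-∀

lemma13 : (G : Graph) (T : Fin (n G) → Fin (n G) → Set) → IsSpanningTree G T →
    (u : Fin (n G)) (α β : Colouring G) → Proper G α → Proper G β →
    (k : ℤ) → (+ 6) ∣ (k - (+ 2) * (+ toℕ (α u) - + toℕ (β u))) →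
    (ℓ : ℕ) (cs : ℕ → Colouring G) → Recolouring G ℓ cs → cs 0 ≡ α →
    (∀ v (P : TPath T u v) → SimplePath P →
       Hv G α cs ℓ P ≡ k + h α β P) →
    ∀ v → cs ℓ v ≡ β v
lemma13 G T tree u α β _ β-proper k 6∣k-2[αu-βu] ℓ cs (proper , _) refl H≡k+h v =
  weight≡⇒colour-≡ (properOnTree (proper ℓ ≤-refl)) (properOnTree β-proper) P
    cℓu≡βu (∙-cancelʳ (- weight α P) _ _ same-h)
  where
  open IsSpanningTree tree
  properOnTree : ∀ {c} → Proper G c → ∀ {x y} → T x y → c x ≢ c y
  properOnTree c-proper e = c-proper _ _ (sub e)
  P = proj₁ (connected u v)
  Hu≡k : Hu G cs u ℓ ≡ k
  Hu≡k = ∙-cancelʳ (+ 0) _ _ (H≡k+h u here ([] ∷ []))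
  cℓu≡βu : cs ℓ u ≡ β u
  cℓu≡βu = Hu≡⇒colour-≡ G cs u ℓ (β u) Hu≡k (mod-divides (∣ᵤ⇒∣ 6∣k-2[αu-βu]))
  same-h : h α (cs ℓ) P ≡ h α β P
  same-h = ∙-cancelˡ k _ _
    (subst (λ H → H + h α (cs ℓ) P ≡ k + h α β P) Hu≡k (H≡k+h v P (proj₂ (connected u v))))
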